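{- Every term of the star combinatory calculus for arithmetic is reducible.
   Context: Star combinatory calculus for arithmetic: types are generated from the ground type $N$ by $\sigma\to\tau$ and $\sigma^*$ ($\to$ associating to the right; every type has the form $\sigma_1\to\cdots\to\sigma_n\to\rho$ with $\rho$ equal to $N$ or a star type). Constants: $0:N$, $S:N\to N$, $R_\sigma:N\to\sigma\to(\sigma\to N\to\sigma)\to\sigma$ for each type $\sigma$; $\Pi_{\sigma,\tau}:\sigma\to\tau\to\sigma$; $\Sigma_{\rho,\sigma,\tau}:(\rho\to\sigma\to\tau)\to(\rho\to\sigma)\to\rho\to\tau$; $\mathfrak{s}_\sigma:\sigma\to\sigma^*$; $\cup_\sigma:\sigma^*\to\sigma^*\to\sigma^*$; $\bigcup_{\sigma,\tau}:\sigma^*\to(\sigma\to\tau^*)\to\tau^*$. Terms: constants, typed variables, applications. Conversions: $\Sigma tqr\rightsquigarrow tr(qr)$; $\Pi tq\rightsquigarrow t$; $\bigcup(\mathfrak{s}t)q\rightsquigarrow qt$; $\bigcup(\cup tq)r\rightsquigarrow\cup(\bigcup tr)(\bigcup qr)$; $R0qr\rightsquigarrow q$; $R(St)qr\rightsquigarrow r(Rtqr)t$. A one-step reduction $t\succ_1 q$ replaces a subterm by its converse according to one conversion; $t\succeq q$ means a finite (possibly empty) chain of one-step reductions. A term is strongly normalizable if there is no infinite chain of one-step reductions starting from it. For $t$ of type $\sigma^*$, the surface elements $\mathrm{SM}(t)$ are: $\{q\}$ if $t=\mathfrak{s}q$; $\mathrm{SM}(q)\cup\mathrm{SM}(r)$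 if $t=\cup qr$; $\emptyset$ otherwise. Reducible terms $\mathrm{Red}_\sigma$ are defined by recursion on types: $t\in\mathrm{Red}_N$ iff $t$ is strongly normalizable; $t\in\mathrm{Red}_{\sigma\to\tau}$ iff $tq\in\mathrm{Red}_\tau$ for all $q\in\mathrm{Red}_\sigma$; $t\in\mathrm{Red}_{\sigma^*}$ iff $t$ is strongly normalizable and, for every term $t'$ with $t\succeq t'$, all surface elements of $t'$ are in $\mathrm{Red}_\sigma$. A term is reducible if it lies in $\mathrm{Red}_\sigma$ for its type $\sigma$. -}

module Defs where

open import Data.Nat using (ℕ)
open import Data.Product using (_×_)
open import Induction.WellFounded using (Acc)
open import Relation.Binary.Construct.Closure.ReflexiveTransitive using (Star)

infixr 5 _⇒_
infixl 9 _·_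
infix 4 _⇝_ _≻₁_ _⪰_ _∈SM_

data Ty : Set where
  N   : Ty
  _⇒_ : Ty → Ty → Ty
  _*  : Ty → Ty

data Tm : Ty → Set where
  var  : ∀ {σ} → ℕ → Tm σ
  𝟘    : Tm N
  S    : Tm (N ⇒ N)
  R    : ∀ σ → Tm (N ⇒ σ ⇒ (σ ⇒ N ⇒ σ) ⇒ σ)
  Π    : ∀ σ τ → Tm (σ ⇒ τ ⇒ σ)
  Σ    : ∀ ρ σ τ → Tm ((ρ ⇒ σ ⇒ τ) ⇒ (ρ ⇒ σ) ⇒ ρ ⇒ τ)
  sg   : ∀ σ → Tm (σ ⇒ σ *)
  ∪    : ∀ σ → Tm (σ * ⇒ σ * ⇒ σ *)
  ⋃    : ∀ σ τ → Tm (σ * ⇒ (σ ⇒ τ *) ⇒ τ *)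
  _·_  : ∀ {σ τ} → Tm (σ ⇒ τ) → Tm σ → Tm τ

data _⇝_ : ∀ {σ} → Tm σ → Tm σ → Set where
  Σ-conv : ∀ {ρ σ τ} (t : Tm (ρ ⇒ σ ⇒ τ)) (q : Tm (ρ ⇒ σ)) (r : Tm ρ) →
           Σ ρ σ τ · t · q · r ⇝ t · r · (q · r)
  Π-conv : ∀ {σ τ} (t : Tm σ) (q : Tm τ) → Π σ τ · t · q ⇝ t
  ⋃sg-conv : ∀ {σ τ} (t : Tm σ) (q : Tm (σ ⇒ τ *)) →
             ⋃ σ τ · (sg σ · t) · q ⇝ q · t
  ⋃∪-conv : ∀ {σ τ} (t q : Tm (σ *)) (r : Tm (σ ⇒ τ *)) →
            ⋃ σ τ · (∪ σ · t · q) · r ⇝ ∪ τ · (⋃ σ τ · t · r) · (⋃ σ τ · q · r)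
  R0-conv : ∀ {σ} (q : Tm σ) (r : Tm (σ ⇒ N ⇒ σ)) → R σ · 𝟘 · q · r ⇝ q
  RS-conv : ∀ {σ} (t : Tm N) (q : Tm σ) (r : Tm (σ ⇒ N ⇒ σ)) →
            R σ · (S · t) · q · r ⇝ r · (R σ · t · q · r) · t

data _≻₁_ : ∀ {σ} → Tm σ → Tm σ → Set where
  conv : ∀ {σ} {t t' : Tm σ} → t ⇝ t' → t ≻₁ t'
  appL : ∀ {σ τ} {t t' : Tm (σ ⇒ τ)} (q : Tm σ) → t ≻₁ t' → t · q ≻₁ t' · q
  appR : ∀ {σ τ} (t : Tm (σ ⇒ τ)) {q q' : Tm σ} → q ≻₁ q' → t · q ≻₁ t · q'

_⪰_ : ∀ {σ} → Tm σ → Tm σ → Set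
_⪰_ = Star _≻₁_

-- Strong normalizability: no infinite reduction chain, stated inductively
-- (accessibility w.r.t. the converse of one-step reduction)
SN : ∀ {σ} → Tm σ → Set
SN t = Acc (λ u v → v ≻₁ u) t

data _∈SM_ : ∀ {σ} → Tm σ → Tm (σ *) → Set where
  here  : ∀ {σ} (q : Tm σ) → q ∈SM (sg σ · q)
  left  : ∀ {σ} {x : Tm σ} {q : Tm (σ *)} (r : Tm (σ *)) → x ∈SM q → x ∈SM (∪ σ · q · r)
  right : ∀ {σ} {x : Tm σ} (q : Tm (σ *)) {r : Tm (σ *)} → x ∈SM r → x ∈SM (∪ σ · q · r)

Red : (σ : Ty) → Tm σ → Set
Red N t = SN t
Red (σ ⇒ τ) t = ∀ (q : Tm σ) → Red σ q → Red τ (t · q)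
Red (σ *) t = SN t × (∀ (t' : Tm (σ *)) → t ⪰ t' → ∀ (q : Tm σ) → q ∈SM t' → Red σ q)

{-# OPTIONS --safe #-}

-- Tait–Girard reducibility. The sets Red σ satisfy Girard's conditions CR1–CR3
-- (reducible terms are strongly normalizing, reducibility is closed under
-- reduction, and a neutral term is reducible once all its one-step reducts are),
-- plus an analogue of CR3 at star types that also asks for reducible surface
-- elements. Each constant is then reducible by induction on the strong
-- normalization of its reducible arguments: a one-step reduct either reduces an
-- argument, covered by the induction hypothesis, or is the contractum, reducible
-- by the hypotheses on the arguments. Since Red (σ ⇒ τ) is closed under
-- application, every term is reducible by induction on its structure.

module Submission where

open import Defs
open import Data.Empty using (⊥-elim)
open import Data.Product using (_×_; _,_; proj₁; proj₂)
open import Function using (id; _∘_)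
open import Induction.WellFounded using (acc; acc-inverse; module Subrelation)
open import Relation.Binary.Core using (_Preserves_⟶_)
import Relation.Binary.Construct.On as On
open import Relation.Binary.Construct.Closure.ReflexiveTransitive using (ε; _◅_; gmap)
open import Relation.Nullary using (¬_)

SN-subterm : ∀ {σ τ} {E : Tm σ → Tm τ} → E Preserves _≻₁_ ⟶ _≻₁_ →
             ∀ {t} → SN (E t) → SN t
SN-subterm {E = E} E-mono = Subrelation.accessible E-mono ∘ On.accessible E

-- Fully applied R, Π, Σ and ⋃ are neutral although they may be redexes: what
-- matters is that applying them further never creates a redex at the root.
data Neutral : ∀ {σ} → Tm σ → Set where
  var : ∀ {σ} n → Neutral (var {σ} n)
  R   : ∀ {σ} n q r → Neutral (R σ · n · q · r)
  Π   : ∀ {σ τ} a b → Neutral (Π σ τ · a · b)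
  Σ   : ∀ {ρ σ τ} a b c → Neutral (Σ ρ σ τ · a · b · c)
  ⋃   : ∀ {σ τ} t r → Neutral (⋃ σ τ · t · r)
  _·_ : ∀ {σ τ} {t : Tm (σ ⇒ τ)} → Neutral t → (q : Tm σ) → Neutral (t · q)

neutral-¬⇝ : ∀ {σ τ} {t : Tm (σ ⇒ τ)} {q u} → Neutral t → ¬ (t · q ⇝ u)
neutral-¬⇝ ((() · _) · _) (Σ-conv _ _ _)
neutral-¬⇝ ((() · _) · _) (R0-conv _ _)
neutral-¬⇝ ((() · _) · _) (RS-conv _ _ _)

neutral-∉SM : ∀ {σ} {t : Tm (σ *)} {x} → Neutral t → ¬ (x ∈SM t)
neutral-∉SM (() · _) (here _)
neutral-∉SM ((() · _) · _) (left _ _)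
neutral-∉SM ((() · _) · _) (right _ _)

var-¬≻₁ : ∀ {σ n} {u : Tm σ} → ¬ (var n ≻₁ u)
var-¬≻₁ (conv ())

Red*-intro : ∀ {σ} {t : Tm (σ *)} → (∀ {q} → q ∈SM t → Red σ q) →
             (∀ {t'} → t ≻₁ t' → Red (σ *) t') → Red (σ *) t
Red*-intro surface reducts = acc (λ p → proj₁ (reducts p)) , λ where
  _  ε        _ q∈ → surface q∈
  t' (p ◅ ps) q q∈ → proj₂ (reducts p) t' ps q q∈

Red⇒SN      : ∀ σ {t} → Red σ t → SN t
Red-step    : ∀ σ {t t'} → Red σ t → t ≻₁ t' → Red σ t'
Red-neutral : ∀ σ {t} → Neutral t → (∀ {t'} → t ≻₁ t' → Red σ t') → Red σ t
var-Red     : ∀ {σ} n → Red σ (var n)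

Red⇒SN N       r = r
Red⇒SN (σ *)   r = proj₁ r
Red⇒SN (σ ⇒ τ) r = SN-subterm (appL (var 0)) (Red⇒SN τ (r (var 0) (var-Red 0)))

Red-step N       r          p = acc-inverse r p
Red-step (σ *)   (sn , sur) p = acc-inverse sn p , λ t' ps → sur t' (p ◅ ps)
Red-step (σ ⇒ τ) r          p q rq = Red-step τ (r q rq) (appL q p)

Red-neutral N       ne reducts = acc reducts
Red-neutral (σ *)   ne reducts = Red*-intro (⊥-elim ∘ neutral-∉SM ne) reducts
Red-neutral (σ ⇒ τ) {t} ne reducts q rq = go (Red⇒SN σ rq) rq
  where
  go : ∀ {q} → SN q → Red σ q → Red τ (t · q)
  go {q} (acc Q) rq = Red-neutral τ (ne · q) λ where
    (conv c)   → ⊥-elim (neutral-¬⇝ ne c)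
    (appL _ p) → reducts p q rq
    (appR _ p) → go (Q p) (Red-step σ rq p)

var-Red {σ} n = Red-neutral σ (var n) (⊥-elim ∘ var-¬≻₁)

SN-S : ∀ {t} → SN t → SN (S · t)
SN-S (acc T) = acc λ where
  (conv ())
  (appL _ (conv ()))
  (appR _ p) → SN-S (T p)

Red-Π : ∀ {σ τ} {a : Tm σ} {b : Tm τ} → Red σ a → Red τ b → Red σ (Π σ τ · a · b)
Red-Π {σ} {τ} ra rb = go (Red⇒SN σ ra) (Red⇒SN τ rb) ra rb
  where
  go : ∀ {a b} → SN a → SN b → Red σ a → Red τ b → Red σ (Π σ τ · a · b)
  go (acc A) (acc B) ra rb = Red-neutral σ (Π _ _) λ where
    (conv (Π-conv _ _))         → ra
    (appL _ (conv ()))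
    (appL _ (appL _ (conv ())))
    (appL _ (appR _ p))         → go (A p) (acc B) (Red-step σ ra p) rb
    (appR _ p)                  → go (acc A) (B p) ra (Red-step τ rb p)

Red-Σ : ∀ {ρ σ τ} {a b c} → Red (ρ ⇒ σ ⇒ τ) a → Red (ρ ⇒ σ) b → Red ρ c →
        Red τ (Σ ρ σ τ · a · b · c)
Red-Σ {ρ} {σ} {τ} ra rb rc =
  go (Red⇒SN (ρ ⇒ σ ⇒ τ) ra) (Red⇒SN (ρ ⇒ σ) rb) (Red⇒SN ρ rc) ra rb rc
  where
  go : ∀ {a b c} → SN a → SN b → SN c →
       Red (ρ ⇒ σ ⇒ τ) a → Red (ρ ⇒ σ) b → Red ρ c → Red τ (Σ ρ σ τ · a · b · c)
  go {a} {b} {c} (acc A) (acc B) (acc C) ra rb rc = Red-neutral τ (Σ a b c) λ where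
    (conv (Σ-conv _ _ _))                → ra c rc (b · c) (rb c rc)
    (appL _ (conv ()))
    (appL _ (appL _ (conv ())))
    (appL _ (appL _ (appL _ (conv ()))))
    (appL _ (appL _ (appR _ p)))         →
      go (A p) (acc B) (acc C) (Red-step (ρ ⇒ σ ⇒ τ) ra p) rb rc
    (appL _ (appR _ p))                  →
      go (acc A) (B p) (acc C) ra (Red-step (ρ ⇒ σ) rb p) rc
    (appR _ p)                           →
      go (acc A) (acc B) (C p) ra rb (Red-step ρ rc p)

Red-sg : ∀ {σ} {a : Tm σ} → Red σ a → Red (σ *) (sg σ · a)
Red-sg {σ} ra = go (Red⇒SN σ ra) ra
  where
  go : ∀ {a} → SN a → Red σ a → Red (σ *) (sg σ · a)
  go (acc A) ra = Red*-intro (λ { (here _) → ra }) λ where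
    (conv ())
    (appL _ (conv ()))
    (appR _ p) → go (A p) (Red-step σ ra p)

Red-∪ : ∀ {σ} {x y : Tm (σ *)} → Red (σ *) x → Red (σ *) y → Red (σ *) (∪ σ · x · y)
Red-∪ {σ} rx ry = go (proj₁ rx) (proj₁ ry) rx ry
  where
  go : ∀ {x y} → SN x → SN y → Red (σ *) x → Red (σ *) y → Red (σ *) (∪ σ · x · y)
  go (acc X) (acc Y) rx ry = Red*-intro
    (λ { (left _ q∈) → proj₂ rx _ ε _ q∈ ; (right _ q∈) → proj₂ ry _ ε _ q∈ })
    λ where
      (conv ())
      (appL _ (conv ()))
      (appL _ (appL _ (conv ())))
      (appL _ (appR _ p))         → go (X p) (acc Y) (Red-step (σ *) rx p) ry
      (appR _ p)                  → go (acc X) (Y p) rx (Red-step (σ *) ry p)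

Red-∪⁻¹ : ∀ {σ} {x y : Tm (σ *)} → Red (σ *) (∪ σ · x · y) → Red (σ *) x × Red (σ *) y
Red-∪⁻¹ {σ} {x} {y} (sn , surface) =
    (SN-subterm in-left sn , λ _ ps q q∈ → surface _ (gmap _ in-left ps) q (left y q∈))
  , (SN-subterm in-right sn , λ _ ps q q∈ → surface _ (gmap _ in-right ps) q (right x q∈))
  where
  in-left : (λ x' → ∪ σ · x' · y) Preserves _≻₁_ ⟶ _≻₁_
  in-left p = appL y (appR (∪ σ) p)
  in-right : (∪ σ · x ·_) Preserves _≻₁_ ⟶ _≻₁_
  in-right = appR (∪ σ · x)

-- RS-conv descends from n = S · t to t, which is not a reduct of n. Carrying the
-- accessibility proof of a context E n, which this step leaves unchanged, makes
-- the recursion structural in n there; Red-⋃ uses the same device for ⋃∪-conv.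
Red-R : ∀ {σ n q r} → SN n → Red σ q → Red (σ ⇒ N ⇒ σ) r → Red σ (R σ · n · q · r)
Red-R {σ} sn rq rr = go id sn (Red⇒SN σ rq) (Red⇒SN (σ ⇒ N ⇒ σ) rr) rq rr
  where
  go : ∀ {E : Tm N → Tm N} → E Preserves _≻₁_ ⟶ _≻₁_ →
       ∀ {n q r} → SN (E n) → SN q → SN r →
       Red σ q → Red (σ ⇒ N ⇒ σ) r → Red σ (R σ · n · q · r)
  reducts : ∀ {E : Tm N → Tm N} → E Preserves _≻₁_ ⟶ _≻₁_ →
            ∀ {n q r} → SN (E n) → SN q → SN r →
            Red σ q → Red (σ ⇒ N ⇒ σ) r → ∀ {u} → R σ · n · q · r ≻₁ u → Red σ u
  go E-mono sEn sq sr rq rr = Red-neutral σ (R _ _ _) (reducts E-mono sEn sq sr rq rr)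
  reducts E-mono sEn sq sr rq rr (conv (R0-conv _ _)) = rq
  reducts {E} E-mono sEn sq sr rq rr (conv (RS-conv t _ _)) =
    rr _ (go E∘S-mono sEn sq sr rq rr) t (SN-subterm E∘S-mono sEn)
    where
    E∘S-mono : (E ∘ (S ·_)) Preserves _≻₁_ ⟶ _≻₁_
    E∘S-mono = E-mono ∘ appR S
  reducts E-mono sEn sq sr rq rr (appL _ (conv ()))
  reducts E-mono sEn sq sr rq rr (appL _ (appL _ (conv ())))
  reducts E-mono sEn sq sr rq rr (appL _ (appL _ (appL _ (conv ()))))
  reducts E-mono (acc En) sq sr rq rr (appL _ (appL _ (appR _ p))) =
    go E-mono (En (E-mono p)) sq sr rq rr
  reducts E-mono sEn (acc Q) sr rq rr (appL _ (appR _ p)) =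
    go E-mono sEn (Q p) sr (Red-step σ rq p) rr
  reducts E-mono sEn sq (acc B) rq rr (appR _ p) =
    go E-mono sEn sq (B p) rq (Red-step (σ ⇒ N ⇒ σ) rr p)

Red-⋃ : ∀ {σ τ t r} → Red (σ *) t → Red (σ ⇒ τ *) r → Red (τ *) (⋃ σ τ · t · r)
Red-⋃ {σ} {τ} rt rr = go id (proj₁ rt) rt (Red⇒SN (σ ⇒ τ *) rr) rr
  where
  go : ∀ {E : Tm (σ *) → Tm (σ *)} → E Preserves _≻₁_ ⟶ _≻₁_ → ∀ {t r} → SN (E t) →
       Red (σ *) t → SN r → Red (σ ⇒ τ *) r → Red (τ *) (⋃ σ τ · t · r)
  reducts : ∀ {E : Tm (σ *) → Tm (σ *)} → E Preserves _≻₁_ ⟶ _≻₁_ → ∀ {t r} → SN (E t) →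
            Red (σ *) t → SN r → Red (σ ⇒ τ *) r → ∀ {u} → ⋃ σ τ · t · r ≻₁ u → Red (τ *) u
  go E-mono sEt rt sr rr = Red-neutral (τ *) (⋃ _ _) (reducts E-mono sEt rt sr rr)
  reducts E-mono sEt rt sr rr (conv (⋃sg-conv x _)) = rr x (proj₂ rt _ ε x (here x))
  reducts E-mono sEt rt sr rr (conv (⋃∪-conv x y _)) =
    let rx , ry = Red-∪⁻¹ rt in
    Red-∪ (go (λ p → E-mono (appL y (appR (∪ σ) p))) sEt rx sr rr)
          (go (λ p → E-mono (appR (∪ σ · x) p)) sEt ry sr rr)
  reducts E-mono sEt rt sr rr (appL _ (conv ()))
  reducts E-mono sEt rt sr rr (appL _ (appL _ (conv ())))
  reducts E-mono (acc Et) rt sr rr (appL _ (appR _ p)) =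
    go E-mono (Et (E-mono p)) (Red-step (σ *) rt p) sr rr
  reducts E-mono sEt rt (acc B) rr (appR _ p) =
    go E-mono sEt rt (B p) (Red-step (σ ⇒ τ *) rr p)

theorem8 : ∀ (σ : Ty) (t : Tm σ) → Red σ t
theorem8 _ (var n)       = var-Red n
theorem8 _ 𝟘             = acc λ { (conv ()) }
theorem8 _ S             = λ _ → SN-S
theorem8 _ (R _)         = λ _ sn _ rq _ rr → Red-R sn rq rr
theorem8 _ (Π _ _)       = λ _ ra _ rb → Red-Π ra rb
theorem8 _ (Σ _ _ _)     = λ _ ra _ rb _ rc → Red-Σ ra rb rc
theorem8 _ (sg _)        = λ _ → Red-sg
theorem8 _ (∪ _)         = λ _ rx _ → Red-∪ rx
theorem8 _ (⋃ _ _)       = λ _ rt _ → Red-⋃ rt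
theorem8 τ (_·_ {σ} t q) = theorem8 (σ ⇒ τ) t q (theorem8 σ q)
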